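{- Let $(X,\mathcal{C})$ be a convex geometry with closure operator $\phi$, let $x\in X$ and $A\subseteq X$. Then $A$ is a critical generator of $x$ if and only if $A=\mathrm{ex}(\phi(A))$ and $\phi(A)$ is an inclusion-minimal element of $\{C: C\in\mathcal{C},\ x\in C,\ x\notin\mathrm{ex}(C)\}$.
   Context: A closure system on a finite set $X$ is a family $\mathcal{C}\subseteq 2^X$ containing $X$ and closed under intersection, with closure operator $\phi(A)=\bigcap\{C\in\mathcal{C}:A\subseteq C\}$. It is a convex geometry if $\emptyset\in\mathcal{C}$ and for every $C\in\mathcal{C}$ with $C\neq X$ there is $y\notin C$ with $C\cup\{y\}\in\mathcal{C}$. For $A\subseteq X$, the extreme points of $A$ are $\mathrm{ex}(A)=\{a\in A: a\notin\phi(A\setminus\{a\})\}$. A minimal generator of $x$ is an inclusion-minimal $A\subseteq X\setminus\{x\}$ with $x\in\phi(A)$; it is a critical generator of $x$ if $\phi(A)\setminus\{a,x\}\in\mathcal{C}$ for every $a\in A$. -}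

module Defs where

open import Data.Nat using (ℕ; zero; suc)
open import Data.Bool using (Bool; true; false; _∧_; not; T)
open import Data.Fin using (Fin)
open import Data.Fin.Subset using (Subset; _∈_; _∉_; _⊆_; _⊂_; _∩_; _∪_; _-_; ⋂; ⁅_⁆; ⊤; ⊥; inside; outside)
open import Data.Fin.Subset.Properties using (_⊆?_; _∈?_)
open import Data.List using (List; []; _∷_; map; _++_; filterᵇ)
open import Data.Vec using (_∷_; []; tabulate)
open import Data.Product using (Σ; ∃; _×_; _,_)
open import Relation.Nullary using (¬_; does)
open import Relation.Binary.PropositionalEquality using (_≡_; _≢_)

-- The ground set X is Fin n; subsets of X are Data.Fin.Subset.Subset n.
-- A family of subsets 𝒞 ⊆ 2^X is given by its characteristic function.
Family : ℕ → Set
Family n = Subset n → Bool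

_∈𝒞_ : ∀ {n} → Subset n → Family n → Set
C ∈𝒞 𝒞 = T (𝒞 C)

allSubsets : (n : ℕ) → List (Subset n)
allSubsets zero = [] ∷ []
allSubsets (suc n) = map (inside ∷_) (allSubsets n) ++ map (outside ∷_) (allSubsets n)

-- closure system: contains X and is closed under intersection
-- (X finite, so closure under binary intersections suffices; the empty
--  intersection is X itself)
IsClosureSystem : ∀ {n} → Family n → Set
IsClosureSystem {n} 𝒞 =
  (⊤ ∈𝒞 𝒞) × (∀ (C D : Subset n) → C ∈𝒞 𝒞 → D ∈𝒞 𝒞 → (C ∩ D) ∈𝒞 𝒞)

φ : ∀ {n} → Family n → Subset n → Subset n
φ {n} 𝒞 A = ⋂ (filterᵇ (λ C → 𝒞 C ∧ does (A ⊆? C)) (allSubsets n))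

IsConvexGeometry : ∀ {n} → Family n → Set
IsConvexGeometry {n} 𝒞 =
  IsClosureSystem 𝒞 × (⊥ ∈𝒞 𝒞) ×
  (∀ (C : Subset n) → C ∈𝒞 𝒞 → C ≢ ⊤ →
     ∃ λ (y : Fin n) → y ∉ C × ((C ∪ ⁅ y ⁆) ∈𝒞 𝒞))

ex : ∀ {n} → Family n → Subset n → Subset n
ex 𝒞 A = tabulate (λ a → does (a ∈? A) ∧ not (does (a ∈? φ 𝒞 (A - a))))

IsMinimalGenerator : ∀ {n} → Family n → Fin n → Subset n → Set
IsMinimalGenerator {n} 𝒞 x A =
  x ∉ A × x ∈ φ 𝒞 A × (∀ (B : Subset n) → B ⊂ A → x ∉ φ 𝒞 B)

IsCriticalGenerator : ∀ {n} → Family n → Fin n → Subset n → Set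
IsCriticalGenerator 𝒞 x A =
  IsMinimalGenerator 𝒞 x A × (∀ a → a ∈ A → ((φ 𝒞 A - a) - x) ∈𝒞 𝒞)

InTargetFamily : ∀ {n} → Family n → Fin n → Subset n → Set
InTargetFamily 𝒞 x C = C ∈𝒞 𝒞 × x ∈ C × x ∉ ex 𝒞 C

IsMinimalInTarget : ∀ {n} → Family n → Fin n → Subset n → Set
IsMinimalInTarget {n} 𝒞 x C =
  InTargetFamily 𝒞 x C × (∀ (D : Subset n) → InTargetFamily 𝒞 x D → ¬ (D ⊂ C))

-- In a convex geometry every closed F ⊂ P (P closed) extends to a closed
-- F ∪ {y} with y ∈ P ∖ F, and a point a of a closed set C is extreme iff C - a
-- is closed. Let A be a critical generator of x and a ∈ A. Since ex φA ⊆ A ∌ x,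
-- x is not extreme in φA, so φA - x is not closed; hence the one-point
-- extension of the closed set φA - a - x inside φA adds x rather than a, and
-- φA - a is closed: A = ex φA. A closed D ⊂ φA with x ∈ D ∖ ex D contains A,
-- since x ∈ φ(D - x) ⊆ φA - a - x for every a ∈ A ∖ D; so φA is minimal.
-- Conversely, for B ⊂ A the set φB would be a smaller member of the target
-- family, and for a ∈ A the closed set φA - a is too small to belong to it, so
-- x is extreme there and φA - a - x is closed.
module Submission where

open import Defs
open import Data.Nat using (ℕ; zero; suc; _+_; _≤_; _<_)
open import Data.Nat.Properties using (≤-antisym; ≤-trans; m≤m+n; +-suc; +-monoʳ-≤)
open import Data.Bool using (true; _∧_; not; T)
open import Data.Bool.Properties using (T-∧)
open import Data.Fin using (Fin)
open import Data.Fin.Properties using (_≟_)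
open import Data.Fin.Subset using (Subset; _∈_; _∉_; _⊆_; _⊂_; _∩_; _∪_; _─_; _-_; ⋂; ⁅_⁆; ⊤; inside; outside; ∣_∣)
open import Data.Fin.Subset.Properties
  using (_∈?_; _⊆?_; ∈⊤; ⊆-antisym; x∈p∩q⁺; x∈p∩q⁻; x∈p∪q⁻; p⊆p∪q; q⊆p∪q; x∈⁅x⁆; x∈⁅y⁆⇒x≡y;
         p─q⊆p; x∈p∧x≢y⇒x∈p-y; p─x─y≡p─y─x; x∈p⇒p-x⊂p; p⊂q⇒∣p∣<∣q∣; ∣p∣≤n; ∣p∣≡n⇒p≡⊤)
open import Data.List using (List; []; _∷_; map; filterᵇ)
open import Data.List.Membership.Propositional using () renaming (_∈_ to _∈ˡ_)
open import Data.List.Membership.Propositional.Properties using (∈-map⁺; ∈-++⁺ˡ; ∈-++⁺ʳ; ∈-filter⁺; ∈-filter⁻)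
open import Data.List.Relation.Unary.Any using () renaming (here to hereˡ; there to thereˡ)
open import Data.Vec using (_∷_; []; here; there)
open import Data.Vec.Properties using ([]=⇒lookup; lookup⇒[]=; lookup∘tabulate)
open import Data.Product using (∃; _×_; _,_; proj₁; proj₂)
open import Data.Sum using (_⊎_; inj₁; inj₂)
open import Data.Empty using (⊥-elim)
open import Function.Bundles using (_⇔_; mk⇔; Equivalence)
open import Relation.Nullary using (¬_; Dec; does; yes; no; contradiction; T?)
open import Relation.Binary.PropositionalEquality using (_≡_; _≢_; refl; sym; trans; subst)

private
  variable
    n : ℕ
    P Q : Set

T-does : (P? : Dec P) → T (does P?) ⇔ P
T-does (yes p) = mk⇔ (λ _ → p) (λ _ → _)
T-does (no ¬p) = mk⇔ (λ ()) ¬p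

does∧not≡true : (P? : Dec P) (Q? : Dec Q) → (does P? ∧ not (does Q?)) ≡ true ⇔ (P × ¬ Q)
does∧not≡true (yes p) (no ¬q) = mk⇔ (λ _ → p , ¬q) (λ _ → refl)
does∧not≡true (yes _) (yes q) = mk⇔ (λ ()) (λ (_ , ¬q) → contradiction q ¬q)
does∧not≡true (no ¬p) _       = mk⇔ (λ ()) (λ (p , _) → contradiction p ¬p)

∈-allSubsets : (C : Subset n) → C ∈ˡ allSubsets n
∈-allSubsets []            = hereˡ refl
∈-allSubsets (inside ∷ C)  = ∈-++⁺ˡ (∈-map⁺ (inside ∷_) (∈-allSubsets C))
∈-allSubsets (outside ∷ C) =
  ∈-++⁺ʳ (map (inside ∷_) (allSubsets _)) (∈-map⁺ (outside ∷_) (∈-allSubsets C))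

⊆-⋂ : {A : Subset n} (Cs : List (Subset n)) → (∀ {C} → C ∈ˡ Cs → A ⊆ C) → A ⊆ ⋂ Cs
⊆-⋂ []       A⊆Cs x∈A = ∈⊤
⊆-⋂ (C ∷ Cs) A⊆Cs x∈A = x∈p∩q⁺ (A⊆Cs (hereˡ refl) x∈A , ⊆-⋂ Cs (λ C∈Cs → A⊆Cs (thereˡ C∈Cs)) x∈A)

⋂-⊆ : {C : Subset n} (Cs : List (Subset n)) → C ∈ˡ Cs → ⋂ Cs ⊆ C
⋂-⊆ (C ∷ Cs) (hereˡ refl)  x∈⋂ = proj₁ (x∈p∩q⁻ C (⋂ Cs) x∈⋂)
⋂-⊆ (D ∷ Cs) (thereˡ C∈Cs) x∈⋂ = ⋂-⊆ Cs C∈Cs (proj₂ (x∈p∩q⁻ D (⋂ Cs) x∈⋂))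

x∈p─q⇒x∉q : ∀ (p q : Subset n) {x} → x ∈ p ─ q → x ∉ q
x∈p─q⇒x∉q (_ ∷ p) (outside ∷ q) here          ()
x∈p─q⇒x∉q (_ ∷ p) (outside ∷ q) (there x∈p─q) (there x∈q) = x∈p─q⇒x∉q p q x∈p─q x∈q
x∈p─q⇒x∉q (_ ∷ p) (inside  ∷ q) (there x∈p─q) (there x∈q) = x∈p─q⇒x∉q p q x∈p─q x∈q

x∈p-y⇒x∈p : ∀ {p : Subset n} {x y} → x ∈ p - y → x ∈ p
x∈p-y⇒x∈p {p = p} {y = y} = p─q⊆p p ⁅ y ⁆

x∈p-y⇒x≢y : ∀ {p : Subset n} {x y} → x ∈ p - y → x ≢ y
x∈p-y⇒x≢y {p = p} {x} x∈p-y refl = x∈p─q⇒x∉q p ⁅ x ⁆ x∈p-y (x∈⁅x⁆ x)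

x∉p-x : ∀ {p : Subset n} {x} → x ∉ p - x
x∉p-x x∈p-x = x∈p-y⇒x≢y x∈p-x refl

x∉p-x-y : ∀ {p : Subset n} {x y} → x ∉ p - x - y
x∉p-x-y x∈p-x-y = x∉p-x (x∈p-y⇒x∈p x∈p-x-y)

x∈p∧x∉p-y⇒x≡y : ∀ {p : Subset n} {x y} → x ∈ p → x ∉ p - y → x ≡ y
x∈p∧x∉p-y⇒x≡y {x = x} {y} x∈p x∉p-y with x ≟ y
... | yes x≡y = x≡y
... | no  x≢y = contradiction (x∈p∧x≢y⇒x∈p-y x∈p x≢y) x∉p-y

x∈p∧x∉p-y-z : ∀ {p : Subset n} {x y z} → x ∈ p → x ∉ p - y - z → x ≡ y ⊎ x ≡ z
x∈p∧x∉p-y-z {x = x} {y} {z} x∈p x∉p-y-z with x ≟ z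
... | yes x≡z = inj₂ x≡z
... | no  x≢z = inj₁ (x∈p∧x∉p-y⇒x≡y x∈p (λ x∈p-y → x∉p-y-z (x∈p∧x≢y⇒x∈p-y x∈p-y x≢z)))

p⊆p-x∪⁅x⁆ : ∀ {p : Subset n} {x} → p ⊆ (p - x) ∪ ⁅ x ⁆
p⊆p-x∪⁅x⁆ {p = p} {x} {y} y∈p with y ≟ x
... | yes refl = q⊆p∪q (p - x) ⁅ x ⁆ (x∈⁅x⁆ x)
... | no  y≢x  = p⊆p∪q ⁅ x ⁆ (x∈p∧x≢y⇒x∈p-y y∈p y≢x)

x∉p∧x≢y⇒x∉p∪⁅y⁆ : ∀ {p : Subset n} {x y} → x ∉ p → x ≢ y → x ∉ p ∪ ⁅ y ⁆
x∉p∧x≢y⇒x∉p∪⁅y⁆ {p = p} {y = y} x∉p x≢y x∈p∪y with x∈p∪q⁻ p ⁅ y ⁆ x∈p∪y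
... | inj₁ x∈p = x∉p x∈p
... | inj₂ x∈y = x≢y (x∈⁅y⁆⇒x≡y y x∈y)

x∉p⇒∣p∣<∣p∪⁅x⁆∣ : ∀ {p : Subset n} {x} → x ∉ p → ∣ p ∣ < ∣ p ∪ ⁅ x ⁆ ∣
x∉p⇒∣p∣<∣p∪⁅x⁆∣ {p = p} {x} x∉p = p⊂q⇒∣p∣<∣q∣ (p⊆p∪q ⁅ x ⁆ , x , q⊆p∪q p ⁅ x ⁆ (x∈⁅x⁆ x) , x∉p)

module ClosureOperator (𝒞 : Family n) where

  candidates : Subset n → List (Subset n)
  candidates A = filterᵇ (λ C → 𝒞 C ∧ does (A ⊆? C)) (allSubsets n)

  ∈-candidates⁻ : ∀ A {C} → C ∈ˡ candidates A → C ∈𝒞 𝒞 × A ⊆ C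
  ∈-candidates⁻ A {C} C∈ =
    let C∈𝒞 , A⊆?C = Equivalence.to T-∧ (proj₂ (∈-filter⁻ (λ D → T? (𝒞 D ∧ does (A ⊆? D))) {xs = allSubsets n} C∈))
    in C∈𝒞 , Equivalence.to (T-does (A ⊆? C)) A⊆?C

  ∈-candidates⁺ : ∀ A {C} → C ∈𝒞 𝒞 → A ⊆ C → C ∈ˡ candidates A
  ∈-candidates⁺ A {C} C∈𝒞 A⊆C =
    ∈-filter⁺ (λ D → T? (𝒞 D ∧ does (A ⊆? D))) (∈-allSubsets C)
      (Equivalence.from T-∧ (C∈𝒞 , Equivalence.from (T-does (A ⊆? C)) A⊆C))

  φ-extensive : ∀ A → A ⊆ φ 𝒞 A
  φ-extensive A = ⊆-⋂ (candidates A) (λ C∈ → proj₂ (∈-candidates⁻ A C∈))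

  φ-least : ∀ {A C} → C ∈𝒞 𝒞 → A ⊆ C → φ 𝒞 A ⊆ C
  φ-least {A} C∈𝒞 A⊆C = ⋂-⊆ _ (∈-candidates⁺ A C∈𝒞 A⊆C)

  φ-mono : ∀ {A B} → A ⊆ B → φ 𝒞 A ⊆ φ 𝒞 B
  φ-mono {A} {B} A⊆B = ⊆-⋂ (candidates B) λ C∈ →
    let C∈𝒞 , B⊆C = ∈-candidates⁻ B C∈ in φ-least C∈𝒞 (λ x∈A → B⊆C (A⊆B x∈A))

  ∈ex⇔ : ∀ {C a} → a ∈ ex 𝒞 C ⇔ (a ∈ C × a ∉ φ 𝒞 (C - a))
  ∈ex⇔ {C} {a} = mk⇔
    (λ a∈ex → Equivalence.to entry≡true (trans (sym (lookup∘tabulate _ a)) ([]=⇒lookup a∈ex)))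
    (λ a∈C∖φ → lookup⇒[]= a (ex 𝒞 C) (trans (lookup∘tabulate _ a) (Equivalence.from entry≡true a∈C∖φ)))
    where
    entry≡true : (does (a ∈? C) ∧ not (does (a ∈? φ 𝒞 (C - a)))) ≡ true ⇔ (a ∈ C × a ∉ φ 𝒞 (C - a))
    entry≡true = does∧not≡true (a ∈? C) (a ∈? φ 𝒞 (C - a))

  ∉ex⇒∈φ : ∀ {C a} → a ∈ C → a ∉ ex 𝒞 C → a ∈ φ 𝒞 (C - a)
  ∉ex⇒∈φ {C} {a} a∈C a∉ex with a ∈? φ 𝒞 (C - a)
  ... | yes a∈φ = a∈φ
  ... | no  a∉φ = contradiction (Equivalence.from ∈ex⇔ (a∈C , a∉φ)) a∉ex

  separated⇒∈ex : ∀ {C G a} → a ∈ C → G ∈𝒞 𝒞 → C - a ⊆ G → a ∉ G → a ∈ ex 𝒞 C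
  separated⇒∈ex a∈C G∈𝒞 C-a⊆G a∉G =
    Equivalence.from ∈ex⇔ (a∈C , λ a∈φ → a∉G (φ-least G∈𝒞 C-a⊆G a∈φ))

  ex-φ⊆ : ∀ A → ex 𝒞 (φ 𝒞 A) ⊆ A
  ex-φ⊆ A {e} e∈ex with e ∈? A | Equivalence.to (∈ex⇔ {φ 𝒞 A} {e}) e∈ex
  ... | yes e∈A | _ = e∈A
  ... | no  e∉A | e∈φA , e∉φ[φA-e] = contradiction (φ-mono A⊆φA-e e∈φA) e∉φ[φA-e]
    where
    A⊆φA-e : A ⊆ φ 𝒞 A - e
    A⊆φA-e a∈A = x∈p∧x≢y⇒x∈p-y (φ-extensive A a∈A) (λ { refl → e∉A a∈A })

module ClosureSystem {𝒞 : Family n} (cs : IsClosureSystem 𝒞) where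
  open ClosureOperator 𝒞 public

  ∩-closed : ∀ C D → C ∈𝒞 𝒞 → D ∈𝒞 𝒞 → (C ∩ D) ∈𝒞 𝒞
  ∩-closed = proj₂ cs

  ⋂-closed : (Cs : List (Subset n)) → (∀ {C} → C ∈ˡ Cs → C ∈𝒞 𝒞) → ⋂ Cs ∈𝒞 𝒞
  ⋂-closed []       Cs⊆𝒞 = proj₁ cs
  ⋂-closed (C ∷ Cs) Cs⊆𝒞 =
    ∩-closed C (⋂ Cs) (Cs⊆𝒞 (hereˡ refl)) (⋂-closed Cs (λ C∈ → Cs⊆𝒞 (thereˡ C∈)))

  φ-closed : ∀ A → φ 𝒞 A ∈𝒞 𝒞
  φ-closed A = ⋂-closed (candidates A) (λ C∈ → proj₁ (∈-candidates⁻ A C∈))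

  φ⊆⇒closed : ∀ {A} → φ 𝒞 A ⊆ A → A ∈𝒞 𝒞
  φ⊆⇒closed {A} φA⊆A = subst (_∈𝒞 𝒞) (⊆-antisym φA⊆A (φ-extensive A)) (φ-closed A)

  ∈ex⇒-closed : ∀ {C a} → C ∈𝒞 𝒞 → a ∈ ex 𝒞 C → (C - a) ∈𝒞 𝒞
  ∈ex⇒-closed {C} {a} C∈𝒞 a∈ex = φ⊆⇒closed λ w∈φ →
    x∈p∧x≢y⇒x∈p-y (φ-least {C - a} C∈𝒞 x∈p-y⇒x∈p w∈φ)
                   (λ { refl → proj₂ (Equivalence.to ∈ex⇔ a∈ex) w∈φ })

module ConvexGeometry {𝒞 : Family n} (cg : IsConvexGeometry 𝒞) where
  open ClosureSystem (proj₁ cg) public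

  augment : ∀ C → C ∈𝒞 𝒞 → C ≢ ⊤ → ∃ λ y → y ∉ C × (C ∪ ⁅ y ⁆) ∈𝒞 𝒞
  augment = proj₂ (proj₂ cg)

  OnePointExtension : Subset n → Subset n → Set
  OnePointExtension F P = ∃ λ y → y ∈ P × y ∉ F × (F ∪ ⁅ y ⁆) ∈𝒞 𝒞

  -- Grow a closed G ⊇ F with G ∩ P = F by the axiom of convex geometries
  -- until the added point falls into P; then F ∪ {y} = (G ∪ {y}) ∩ P.
  module _ {F P : Subset n} (P∈𝒞 : P ∈𝒞 𝒞) (F⊆P : F ⊆ P) {z} (z∈P : z ∈ P) (z∉F : z ∉ F) where

    Avoiding : Subset n → Set
    Avoiding G = G ∈𝒞 𝒞 × F ⊆ G × (∀ {w} → w ∈ G → w ∈ P → w ∈ F)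

    avoiding≢⊤ : ∀ {G} → Avoiding G → G ≢ ⊤
    avoiding≢⊤ (_ , _ , G∩P⊆F) refl = z∉F (G∩P⊆F ∈⊤ z∈P)

    extend-or-grow : ∀ {G} → Avoiding G →
                     OnePointExtension F P ⊎ ∃ λ G′ → Avoiding G′ × ∣ G ∣ < ∣ G′ ∣
    extend-or-grow {G} avoid@(G∈𝒞 , F⊆G , G∩P⊆F) with augment G G∈𝒞 (avoiding≢⊤ avoid)
    ... | y , y∉G , G∪y∈𝒞 with y ∈? P
    ... | yes y∈P = inj₁ (y , y∈P , (λ y∈F → y∉G (F⊆G y∈F)) ,
                          subst (_∈𝒞 𝒞) G∪y∩P≡F∪y (∩-closed _ P G∪y∈𝒞 P∈𝒞))
      where
      G∪y∩P≡F∪y : (G ∪ ⁅ y ⁆) ∩ P ≡ F ∪ ⁅ y ⁆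
      G∪y∩P≡F∪y = ⊆-antisym ⊆F∪y ⊆G∪y∩P
        where
        ⊆F∪y : (G ∪ ⁅ y ⁆) ∩ P ⊆ F ∪ ⁅ y ⁆
        ⊆F∪y w∈ with x∈p∩q⁻ (G ∪ ⁅ y ⁆) P w∈
        ... | w∈G∪y , w∈P with x∈p∪q⁻ G ⁅ y ⁆ w∈G∪y
        ... | inj₁ w∈G = p⊆p∪q ⁅ y ⁆ (G∩P⊆F w∈G w∈P)
        ... | inj₂ w∈y = q⊆p∪q F ⁅ y ⁆ w∈y
        ⊆G∪y∩P : F ∪ ⁅ y ⁆ ⊆ (G ∪ ⁅ y ⁆) ∩ P
        ⊆G∪y∩P w∈ with x∈p∪q⁻ F ⁅ y ⁆ w∈
        ... | inj₁ w∈F = x∈p∩q⁺ (p⊆p∪q ⁅ y ⁆ (F⊆G w∈F) , F⊆P w∈F)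
        ... | inj₂ w∈y with refl ← x∈⁅y⁆⇒x≡y y w∈y = x∈p∩q⁺ (q⊆p∪q G ⁅ y ⁆ w∈y , y∈P)
    ... | no  y∉P =
      inj₂ (G ∪ ⁅ y ⁆ , (G∪y∈𝒞 , (λ w∈F → p⊆p∪q ⁅ y ⁆ (F⊆G w∈F)) , G∪y∩P⊆F) , x∉p⇒∣p∣<∣p∪⁅x⁆∣ y∉G)
      where
      G∪y∩P⊆F : ∀ {w} → w ∈ G ∪ ⁅ y ⁆ → w ∈ P → w ∈ F
      G∪y∩P⊆F w∈G∪y w∈P with x∈p∪q⁻ G ⁅ y ⁆ w∈G∪y
      ... | inj₁ w∈G = G∩P⊆F w∈G w∈P
      ... | inj₂ w∈y with refl ← x∈⁅y⁆⇒x≡y y w∈y = contradiction w∈P y∉P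

    -- The fuel k bounds the number of points G can still gain.
    extension-within : ∀ k {G} → Avoiding G → n ≤ k + ∣ G ∣ → OnePointExtension F P
    extension-within zero    {G} avoid n≤∣G∣ =
      contradiction (∣p∣≡n⇒p≡⊤ (≤-antisym (∣p∣≤n G) n≤∣G∣)) (avoiding≢⊤ avoid)
    extension-within (suc k) {G} avoid n≤1+k+∣G∣ with extend-or-grow avoid
    ... | inj₁ extension             = extension
    ... | inj₂ (G′ , avoid′ , ∣G∣<∣G′∣) =
      extension-within k avoid′
        (≤-trans n≤1+k+∣G∣ (subst (_≤ k + ∣ G′ ∣) (+-suc k ∣ G ∣) (+-monoʳ-≤ k ∣G∣<∣G′∣)))

  ⊂-extension : ∀ {F P} → F ∈𝒞 𝒞 → P ∈𝒞 𝒞 → F ⊂ P → OnePointExtension F P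
  ⊂-extension {F} F∈𝒞 P∈𝒞 (F⊆P , _ , z∈P , z∉F) =
    extension-within P∈𝒞 F⊆P z∈P z∉F n (F∈𝒞 , (λ w∈F → w∈F) , (λ w∈F _ → w∈F)) (m≤m+n n ∣ F ∣)

  removable-pair⇒∈ex : ∀ {C x a} → C ∈𝒞 𝒞 → x ∈ C → x ∉ ex 𝒞 C → a ∈ C → a ≢ x →
                       (C - a - x) ∈𝒞 𝒞 → a ∈ ex 𝒞 C
  removable-pair⇒∈ex {C} {x} {a} C∈𝒞 x∈C x∉ex a∈C a≢x C-a-x∈𝒞
    with ⊂-extension C-a-x∈𝒞 C∈𝒞 ((λ w∈ → x∈p-y⇒x∈p (x∈p-y⇒x∈p w∈)) , a , a∈C , x∉p-x-y {p = C})
  ... | y , y∈C , y∉C-a-x , C-a-x∪y∈𝒞 with x∈p∧x∉p-y-z y∈C y∉C-a-x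
  ... | inj₁ refl = contradiction (separated⇒∈ex x∈C C-a-x∪y∈𝒞 C-x⊆C-a-x∪a x∉C-a-x∪a) x∉ex
    where
    C-x⊆C-a-x∪a : C - x ⊆ (C - a - x) ∪ ⁅ a ⁆
    C-x⊆C-a-x∪a = subst (λ S → C - x ⊆ S ∪ ⁅ a ⁆) (p─x─y≡p─y─x C x a) p⊆p-x∪⁅x⁆
    x∉C-a-x∪a : x ∉ (C - a - x) ∪ ⁅ a ⁆
    x∉C-a-x∪a = x∉p∧x≢y⇒x∉p∪⁅y⁆ x∉p-x (λ x≡a → a≢x (sym x≡a))
  ... | inj₂ refl =
    separated⇒∈ex a∈C C-a-x∪y∈𝒞 p⊆p-x∪⁅x⁆ (x∉p∧x≢y⇒x∉p∪⁅y⁆ (x∉p-x-y {p = C}) a≢x)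

  critical⇒≡exφ : ∀ {x A} → IsCriticalGenerator 𝒞 x A → A ≡ ex 𝒞 (φ 𝒞 A)
  critical⇒≡exφ {x} {A} ((x∉A , x∈φA , _) , removable) = ⊆-antisym A⊆exφA (ex-φ⊆ A)
    where
    A⊆exφA : A ⊆ ex 𝒞 (φ 𝒞 A)
    A⊆exφA {a} a∈A = removable-pair⇒∈ex (φ-closed A) x∈φA (λ x∈ex → x∉A (ex-φ⊆ A x∈ex))
                       (φ-extensive A a∈A) (λ { refl → x∉A a∈A }) (removable a a∈A)

  critical⇒minimalInTarget : ∀ {x A} → IsCriticalGenerator 𝒞 x A → IsMinimalInTarget 𝒞 x (φ 𝒞 A)
  critical⇒minimalInTarget {x} {A} ((x∉A , x∈φA , _) , removable) =
    (φ-closed A , x∈φA , λ x∈ex → x∉A (ex-φ⊆ A x∈ex)) , no-smaller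
    where
    no-smaller : ∀ D → InTargetFamily 𝒞 x D → ¬ (D ⊂ φ 𝒞 A)
    no-smaller D (D∈𝒞 , x∈D , x∉exD) (D⊆φA , z , z∈φA , z∉D) = z∉D (φ-least D∈𝒞 A⊆D z∈φA)
      where
      A⊆D : A ⊆ D
      A⊆D {a} a∈A with a ∈? D
      ... | yes a∈D = a∈D
      ... | no  a∉D = contradiction (φ-least (removable a a∈A) D-x⊆φA-a-x (∉ex⇒∈φ x∈D x∉exD)) x∉p-x
        where
        D-x⊆φA-a-x : D - x ⊆ φ 𝒞 A - a - x
        D-x⊆φA-a-x w∈ = x∈p∧x≢y⇒x∈p-y
          (x∈p∧x≢y⇒x∈p-y (D⊆φA (x∈p-y⇒x∈p w∈)) (λ { refl → a∉D (x∈p-y⇒x∈p w∈) }))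
          (x∈p-y⇒x≢y w∈)

  extreme∧minimal⇒critical : ∀ {x A} → A ≡ ex 𝒞 (φ 𝒞 A) → IsMinimalInTarget 𝒞 x (φ 𝒞 A) →
                             IsCriticalGenerator 𝒞 x A
  extreme∧minimal⇒critical {x} {A} A≡exφA ((φA∈𝒞 , x∈φA , x∉exφA) , minimal) =
    (x∉A , x∈φA , smaller-not-generating) , removable
    where
    A⊆exφA : A ⊆ ex 𝒞 (φ 𝒞 A)
    A⊆exφA {a} a∈A = subst (a ∈_) A≡exφA a∈A
    x∉A : x ∉ A
    x∉A x∈A = x∉exφA (A⊆exφA x∈A)
    φA-a∈𝒞 : ∀ {a} → a ∈ A → (φ 𝒞 A - a) ∈𝒞 𝒞
    φA-a∈𝒞 a∈A = ∈ex⇒-closed φA∈𝒞 (A⊆exφA a∈A)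

    smaller-not-generating : ∀ B → B ⊂ A → x ∉ φ 𝒞 B
    smaller-not-generating B (B⊆A , a , a∈A , a∉B) x∈φB =
      minimal (φ 𝒞 B) (φ-closed B , x∈φB , λ x∈ex → x∉A (B⊆A (ex-φ⊆ B x∈ex)))
                      (φ-mono B⊆A , a , φ-extensive A a∈A , a∉φB)
      where
      B⊆φA-a : B ⊆ φ 𝒞 A - a
      B⊆φA-a w∈B = x∈p∧x≢y⇒x∈p-y (φ-extensive A (B⊆A w∈B)) (λ { refl → a∉B w∈B })
      a∉φB : a ∉ φ 𝒞 B
      a∉φB a∈φB = x∉p-x (φ-least (φA-a∈𝒞 a∈A) B⊆φA-a a∈φB)

    removable : ∀ a → a ∈ A → (φ 𝒞 A - a - x) ∈𝒞 𝒞
    removable a a∈A = ∈ex⇒-closed (φA-a∈𝒞 a∈A) x∈ex[φA-a]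
      where
      x∈ex[φA-a] : x ∈ ex 𝒞 (φ 𝒞 A - a)
      x∈ex[φA-a] with x ∈? ex 𝒞 (φ 𝒞 A - a)
      ... | yes x∈ex = x∈ex
      ... | no  x∉ex = ⊥-elim (minimal (φ 𝒞 A - a)
                                 (φA-a∈𝒞 a∈A , x∈p∧x≢y⇒x∈p-y x∈φA (λ { refl → x∉A a∈A }) , x∉ex)
                                 (x∈p⇒p-x⊂p (φ-extensive A a∈A)))

proposition5 : ∀ (n : ℕ) (𝒞 : Family n) → IsConvexGeometry 𝒞 →
    ∀ (x : Fin n) (A : Subset n) →
    IsCriticalGenerator 𝒞 x A ⇔ (A ≡ ex 𝒞 (φ 𝒞 A) × IsMinimalInTarget 𝒞 x (φ 𝒞 A))
proposition5 n 𝒞 cg x A = mk⇔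
  (λ critical → critical⇒≡exφ critical , critical⇒minimalInTarget critical)
  (λ (A≡exφA , minimal) → extreme∧minimal⇒critical A≡exφA minimal)
  where open ConvexGeometry cg
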